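{- Let $k\in\mathbb N$, $m\ge 2$ and $p_1,\dots,p_m\in E_k$. Then \[\Big\langle\bigvee_{i=1}^m(u_i^{p_i}=v_i^{p_i})\Big\rangle_{\mathrm{qpp}}=\Big\langle\bigvee_{i=2}^m(u_i^{p_i}=v_i^{p_i}),\ (u_1^{p_1}=v_1^{p_1})\lor(u_2^{p_2}=v_2^{p_2})\Big\rangle_{\mathrm{qpp}}.\] Furthermore, for every $i\in E_k$, $\langle x^i=y^i\lor u^i=v^i\rangle_{\mathrm{qpp}}=\langle x^i=y^i\lor y^i=z^i\rangle_{\mathrm{qpp}}$.
   Context: $E_k=\{1,\dots,k\}$; superscripts denote sorts. A $k$-sorted relation on $\{0,1\}$ is a subset of $\{0,1\}^n$ with each variable assigned a sort in $E_k$; a displayed disjunction of equations denotes the relation on its variables (with indicated sorts) it defines. $\sigma_\bot$ is the empty $0$-ary relation, $\sigma^i_=$ equality on sort $i$. For a set $S$ of relations, $\langle S\rangle_{\mathrm{qpp}}$ is the set of relations definable by formulas built from predicates in $S\cup\{\sigma_\bot,\sigma_=^1,\dots,\sigma_=^k\}$ using conjunction, existential and universal quantification only, each variable having one sort and substituted only into positions of that sort. -}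

module Defs where

open import Data.Nat using (ℕ; zero; suc; _+_)
open import Data.Fin using (Fin; zero; suc; _↑ˡ_; _↑ʳ_; splitAt)
open import Data.Bool using (Bool)
open import Data.Sum using (_⊎_; [_,_])
open import Data.Product using (Σ; ∃; _×_)
open import Data.Empty using (⊥)
open import Data.Vec.Functional using (_∷_; [])
open import Relation.Binary.PropositionalEquality using (_≡_)
open import Function.Bundles using (_⇔_)

-- A k-sorted relation on {0,1}: an arity n, a sort (in E_k = Fin k) for
-- each of its n variables, and a subset of {0,1}^n (as a predicate).
record SRel (k : ℕ) : Set₁ where
  constructor srel
  field
    arity : ℕ
    sort  : Fin arity → Fin k
    pred  : (Fin arity → Bool) → Set

open SRel public

-- qpp-formulas over a family S of base relations, with n free variables
-- (de Bruijn, Fin n) whose sorts are given by σ.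
data Formula {k : ℕ} {I : Set} (S : I → SRel k) : (n : ℕ) → (Fin n → Fin k) → Set where
  atom   : ∀ {n σ} (j : I) (args : Fin (arity (S j)) → Fin n) →
           (∀ i → σ (args i) ≡ sort (S j) i) → Formula S n σ
  falsum : ∀ {n σ} → Formula S n σ
  equal  : ∀ {n σ} (x y : Fin n) → σ x ≡ σ y → Formula S n σ
  conj   : ∀ {n σ} → Formula S n σ → Formula S n σ → Formula S n σ
  exQ    : ∀ {n σ} (s : Fin k) → Formula S (suc n) (s ∷ σ) → Formula S n σ
  allQ   : ∀ {n σ} (s : Fin k) → Formula S (suc n) (s ∷ σ) → Formula S n σ

⟦_⟧ : ∀ {k} {I : Set} {S : I → SRel k} {n σ} → Formula S n σ → (Fin n → Bool) → Set
⟦_⟧ {S = S} (atom j args _) ρ = pred (S j) (λ i → ρ (args i))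
⟦ falsum ⟧ ρ = ⊥
⟦ equal x y _ ⟧ ρ = ρ x ≡ ρ y
⟦ conj φ ψ ⟧ ρ = ⟦ φ ⟧ ρ × ⟦ ψ ⟧ ρ
⟦ exQ s φ ⟧ ρ = Σ Bool λ b → ⟦ φ ⟧ (b ∷ ρ)
⟦ allQ s φ ⟧ ρ = (b : Bool) → ⟦ φ ⟧ (b ∷ ρ)

_∈⟨_⟩ : ∀ {k} {I : Set} → SRel k → (I → SRel k) → Set
R ∈⟨ S ⟩ = Σ (Formula S (arity R) (sort R)) λ φ → ∀ ρ → pred R ρ ⇔ ⟦ φ ⟧ ρ

_≐_ : ∀ {k} {I J : Set} → (I → SRel k) → (J → SRel k) → Set₁
S ≐ T = ∀ R → (R ∈⟨ S ⟩ → R ∈⟨ T ⟩) × (R ∈⟨ T ⟩ → R ∈⟨ S ⟩)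

-- ⋁_{i} (u_i^{p i} = v_i^{p i}) for p : Fin m → Fin k.
-- Variables: u_1..u_m (positions i ↑ˡ m), then v_1..v_m (positions m ↑ʳ i).
DisjEq : ∀ {k} (m : ℕ) → (Fin m → Fin k) → SRel k
DisjEq m p = srel (m + m) (λ j → [ p , p ] (splitAt m j))
                  (λ ρ → ∃ λ i → ρ (i ↑ˡ m) ≡ ρ (m ↑ʳ i))

Chain : ∀ {k} → Fin k → SRel k
Chain s = srel 3 (λ _ → s) (λ ρ → (ρ zero ≡ ρ (suc zero)) ⊎ (ρ (suc zero) ≡ ρ (suc (suc zero))))

single : ∀ {k} → SRel k → Fin 1 → SRel k
single R = R ∷ []

pair : ∀ {k} → SRel k → SRel k → Fin 2 → SRel k
pair R T = R ∷ T ∷ []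

{-# OPTIONS --safe #-}

-- Definability is transitive: substituting defining formulas for the atoms of a qpp-formula
-- preserves its meaning, so it suffices to define the generators of each side from the other.
-- A long disjunction of equalities splits into two shorter ones glued by an existentially
-- quantified variable; a disjunct is removed by quantifying both of its variables universally;
-- and x = y ∨ u = v is defined from chains x = y ∨ y = z with two auxiliary existential variables.

module Submission where

open import Defs
open import Data.Nat using (ℕ; suc; _+_)
open import Data.Fin using (Fin; zero; suc; _↑ˡ_; _↑ʳ_; splitAt; lift; punchIn; punchOut; _≟_)
open import Data.Fin.Properties using (punchIn-punchOut)
open import Data.Product using (Σ; ∃; _×_; _,_; proj₁; proj₂)
open import Data.Product.Function.NonDependent.Propositional using (_×-⇔_)
open import Data.Sum using (inj₁; inj₂)
open import Data.Bool using (Bool; true; false)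
open import Data.Vec.Functional using (_∷_; []; _++_; insertAt)
open import Data.Vec.Functional.Properties using (lookup-++ˡ; lookup-++ʳ; ++-cong; insertAt-lookup; insertAt-punchIn)
open import Function.Base using (id; _∘_)
open import Function.Bundles using (_⇔_; mk⇔; Equivalence)
open import Function.Properties.Equivalence using () renaming (refl to ⇔-refl; sym to ⇔-sym; trans to ⇔-trans)
open import Relation.Nullary using (yes; no; contradiction)
open import Relation.Binary.PropositionalEquality using (_≡_; _≗_; refl; sym; trans; cong; subst; subst₂)

private
  variable
    k n m : ℕ

Σ-cong-⇔ : {A : Set} {P Q : A → Set} → (∀ x → P x ⇔ Q x) → Σ A P ⇔ Σ A Q
Σ-cong-⇔ P⇔Q = mk⇔ (λ (x , p) → x , Equivalence.to (P⇔Q x) p) (λ (x , q) → x , Equivalence.from (P⇔Q x) q)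

Π-cong-⇔ : {A : Set} {P Q : A → Set} → (∀ x → P x ⇔ Q x) → ((x : A) → P x) ⇔ ((x : A) → Q x)
Π-cong-⇔ P⇔Q = mk⇔ (λ p x → Equivalence.to (P⇔Q x) (p x)) (λ q x → Equivalence.from (P⇔Q x) (q x))

∷-lift : {A : Set} {f : Fin n → Fin m} {g : Fin m → A} {h : Fin n → A} (x : A) →
         (∀ i → g (f i) ≡ h i) → ∀ i → (x ∷ g) (lift 1 f i) ≡ (x ∷ h) i
∷-lift x gf≗h zero    = refl
∷-lift x gf≗h (suc i) = gf≗h i

-- Without function extensionality, a relation has to be shown to respect
-- pointwise equal valuations before formulas can be transported along renamings.
Extensional : SRel k → Set
Extensional R = ∀ {ρ ρ′} → ρ ≗ ρ′ → pred R ρ → pred R ρ′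

_⊆⟨_⟩ : {I J : Set} → (I → SRel k) → (J → SRel k) → Set
S ⊆⟨ T ⟩ = ∀ i → S i ∈⟨ T ⟩

module _ {J : Set} {T : J → SRel k} where

  rename : {σ : Fin n → Fin k} {τ : Fin m → Fin k} (f : Fin n → Fin m) →
           (∀ i → τ (f i) ≡ σ i) → Formula T n σ → Formula T m τ
  rename f f-sort (atom j args args-sort) = atom j (f ∘ args) (λ i → trans (f-sort (args i)) (args-sort i))
  rename f f-sort falsum                  = falsum
  rename f f-sort (equal x y xy-sort)     = equal (f x) (f y) (trans (f-sort x) (trans xy-sort (sym (f-sort y))))
  rename f f-sort (conj φ ψ)              = conj (rename f f-sort φ) (rename f f-sort ψ)
  rename f f-sort (exQ s φ)               = exQ s (rename (lift 1 f) (∷-lift s f-sort) φ)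
  rename f f-sort (allQ s φ)              = allQ s (rename (lift 1 f) (∷-lift s f-sort) φ)

  rename-sound : (∀ j → Extensional (T j)) →
                 {σ : Fin n → Fin k} {τ : Fin m → Fin k} (φ : Formula T n σ)
                 (f : Fin n → Fin m) (f-sort : ∀ i → τ (f i) ≡ σ i) {ρ : Fin n → Bool} {ρ′ : Fin m → Bool} →
                 (∀ i → ρ′ (f i) ≡ ρ i) → ⟦ rename {τ = τ} f f-sort φ ⟧ ρ′ ⇔ ⟦ φ ⟧ ρ
  rename-sound T-ext (atom j args _) f f-sort ρ′f≗ρ =
    mk⇔ (T-ext j (ρ′f≗ρ ∘ args)) (T-ext j (sym ∘ ρ′f≗ρ ∘ args))
  rename-sound T-ext falsum f f-sort ρ′f≗ρ = ⇔-refl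
  rename-sound T-ext (equal x y _) f f-sort ρ′f≗ρ =
    mk⇔ (subst₂ _≡_ (ρ′f≗ρ x) (ρ′f≗ρ y)) (subst₂ _≡_ (sym (ρ′f≗ρ x)) (sym (ρ′f≗ρ y)))
  rename-sound T-ext {τ = τ} (conj φ ψ) f f-sort ρ′f≗ρ =
    rename-sound T-ext {τ = τ} φ f f-sort ρ′f≗ρ ×-⇔ rename-sound T-ext {τ = τ} ψ f f-sort ρ′f≗ρ
  rename-sound T-ext {τ = τ} (exQ s φ) f f-sort ρ′f≗ρ =
    Σ-cong-⇔ λ b → rename-sound T-ext {τ = s ∷ τ} φ (lift 1 f) (∷-lift s f-sort) (∷-lift b ρ′f≗ρ)
  rename-sound T-ext {τ = τ} (allQ s φ) f f-sort ρ′f≗ρ =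
    Π-cong-⇔ λ b → rename-sound T-ext {τ = s ∷ τ} φ (lift 1 f) (∷-lift s f-sort) (∷-lift b ρ′f≗ρ)

module _ {I J : Set} {S : I → SRel k} {T : J → SRel k} (S⊆T : S ⊆⟨ T ⟩) where

  translate : {σ : Fin n → Fin k} → Formula S n σ → Formula T n σ
  translate (atom j args args-sort) = rename args args-sort (proj₁ (S⊆T j))
  translate falsum                  = falsum
  translate (equal x y xy-sort)     = equal x y xy-sort
  translate (conj φ ψ)              = conj (translate φ) (translate ψ)
  translate (exQ s φ)               = exQ s (translate φ)
  translate (allQ s φ)              = allQ s (translate φ)

  translate-sound : (∀ j → Extensional (T j)) → {σ : Fin n → Fin k} (φ : Formula S n σ) (ρ : Fin n → Bool) →
                    ⟦ translate φ ⟧ ρ ⇔ ⟦ φ ⟧ ρ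
  translate-sound T-ext {σ} (atom j args args-sort) ρ =
    ⇔-trans (rename-sound T-ext {τ = σ} (proj₁ (S⊆T j)) args args-sort λ _ → refl) (⇔-sym (proj₂ (S⊆T j) (ρ ∘ args)))
  translate-sound T-ext falsum        ρ = ⇔-refl
  translate-sound T-ext (equal _ _ _) ρ = ⇔-refl
  translate-sound T-ext (conj φ ψ)    ρ = translate-sound T-ext φ ρ ×-⇔ translate-sound T-ext ψ ρ
  translate-sound T-ext (exQ s φ)     ρ = Σ-cong-⇔ λ b → translate-sound T-ext φ (b ∷ ρ)
  translate-sound T-ext (allQ s φ)    ρ = Π-cong-⇔ λ b → translate-sound T-ext φ (b ∷ ρ)

  ∈⟨⟩-trans : (∀ j → Extensional (T j)) → {R : SRel k} → R ∈⟨ S ⟩ → R ∈⟨ T ⟩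
  ∈⟨⟩-trans T-ext (φ , φ-defines) = translate φ , λ ρ → ⇔-trans (φ-defines ρ) (⇔-sym (translate-sound T-ext φ ρ))

≐-intro : {I J : Set} {S : I → SRel k} {T : J → SRel k} →
          (∀ i → Extensional (S i)) → (∀ j → Extensional (T j)) → S ⊆⟨ T ⟩ → T ⊆⟨ S ⟩ → S ≐ T
≐-intro S-ext T-ext S⊆T T⊆S R = ∈⟨⟩-trans S⊆T T-ext , ∈⟨⟩-trans T⊆S S-ext

DisjEq-extensional : (p : Fin m → Fin k) → Extensional (DisjEq m p)
DisjEq-extensional p ρ≗ρ′ (i , e) = i , subst₂ _≡_ (ρ≗ρ′ _) (ρ≗ρ′ _) e

Chain-extensional : (s : Fin k) → Extensional (Chain s)
Chain-extensional s ρ≗ρ′ (inj₁ e) = inj₁ (subst₂ _≡_ (ρ≗ρ′ _) (ρ≗ρ′ _) e)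
Chain-extensional s ρ≗ρ′ (inj₂ e) = inj₂ (subst₂ _≡_ (ρ≗ρ′ _) (ρ≗ρ′ _) e)

single-extensional : {R : SRel k} → Extensional R → ∀ i → Extensional (single R i)
single-extensional R-ext zero = R-ext

pair-extensional : {R R′ : SRel k} → Extensional R → Extensional R′ → ∀ i → Extensional (pair R R′ i)
pair-extensional R-ext R′-ext zero       = R-ext
pair-extensional R-ext R′-ext (suc zero) = R′-ext

++-sort : {p : Fin m → Fin k} (τ : Fin n → Fin k) (us vs : Fin m → Fin n) →
          (∀ i → τ (us i) ≡ p i) → (∀ i → τ (vs i) ≡ p i) → ∀ j → τ ((us ++ vs) j) ≡ sort (DisjEq m p) j
++-sort {m = m} τ us vs us-sort vs-sort j with splitAt m j
... | inj₁ i = us-sort i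
... | inj₂ i = vs-sort i

DisjEq-++ : {p : Fin m → Fin k} (ρ : Fin n → Bool) (us vs : Fin m → Fin n) →
            pred (DisjEq m p) (ρ ∘ (us ++ vs)) ⇔ ∃ λ i → ρ (us i) ≡ ρ (vs i)
DisjEq-++ ρ us vs = mk⇔
  (λ (i , e) → i , subst₂ _≡_ (cong ρ (lookup-++ˡ us vs i)) (cong ρ (lookup-++ʳ us vs i)) e)
  (λ (i , e) → i , subst₂ _≡_ (sym (cong ρ (lookup-++ˡ us vs i))) (sym (cong ρ (lookup-++ʳ us vs i))) e)

data PunchInView (i : Fin (suc n)) : Fin (suc n) → Set where
  here  : PunchInView i i
  there : (j : Fin n) → PunchInView i (punchIn i j)

punchInView : (i a : Fin (suc n)) → PunchInView i a
punchInView i a with i ≟ a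
... | yes refl = here
... | no i≢a   = subst (PunchInView i) (punchIn-punchOut i≢a) (there (punchOut i≢a))

module _ (p : Fin (suc m) → Fin k) (i : Fin (suc m)) where

  private
    q : Fin m → Fin k
    q = p ∘ punchIn i

    -- Context of the defining formula: b, a, then the variables of DisjEq m q.
    τ : Fin (2 + (m + m)) → Fin k
    τ = p i ∷ p i ∷ sort (DisjEq m q)

    us vs : Fin (suc m) → Fin (2 + (m + m))
    us = insertAt (λ j → suc (suc (j ↑ˡ m))) i (suc zero)
    vs = insertAt (λ j → suc (suc (m ↑ʳ j))) i zero

    insertAt-sort : (xs : Fin m → Fin (2 + (m + m))) (x : Fin (2 + (m + m))) →
                    (∀ j → τ (xs j) ≡ q j) → τ x ≡ p i → ∀ a → τ (insertAt xs i x a) ≡ p a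
    insertAt-sort xs x xs-sort x-sort a with punchInView i a
    ... | here    = trans (cong τ (insertAt-lookup xs i x)) x-sort
    ... | there j = trans (cong τ (insertAt-punchIn xs i x j)) (xs-sort j)

    φ : Formula (single (DisjEq (suc m) p)) (m + m) (sort (DisjEq m q))
    φ = allQ (p i) (allQ (p i) (atom zero (us ++ vs)
          (++-sort τ us vs (insertAt-sort _ _ (lookup-++ˡ q q) refl) (insertAt-sort _ _ (lookup-++ʳ q q) refl))))

    Instance : (Fin (m + m) → Bool) → Bool → Bool → Set
    Instance ρ a b = ∃ λ c → (b ∷ a ∷ ρ) (us c) ≡ (b ∷ a ∷ ρ) (vs c)

    φ-sem : ∀ ρ → ⟦ φ ⟧ ρ ⇔ (∀ a b → Instance ρ a b)
    φ-sem ρ = Π-cong-⇔ λ a → Π-cong-⇔ λ b → DisjEq-++ {p = p} (b ∷ a ∷ ρ) us vs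

    -- Instantiating a ≠ b falsifies the i-th disjunct, so some other one must hold.
    drop-disjunct : ∀ ρ → pred (DisjEq m q) ρ ⇔ (∀ a b → Instance ρ a b)
    drop-disjunct ρ = mk⇔ keep (λ h → from (h true false))
      where
      keep : pred (DisjEq m q) ρ → ∀ a b → Instance ρ a b
      keep (j , e) a b = punchIn i j ,
        subst₂ (λ x y → (b ∷ a ∷ ρ) x ≡ (b ∷ a ∷ ρ) y)
               (sym (insertAt-punchIn _ i _ j)) (sym (insertAt-punchIn _ i _ j)) e

      from : Instance ρ true false → pred (DisjEq m q) ρ
      from (c , e) with punchInView i c
      ... | here    = contradiction (subst₂ (λ x y → (false ∷ true ∷ ρ) x ≡ (false ∷ true ∷ ρ) y)
                                            (insertAt-lookup _ i _) (insertAt-lookup _ i _) e) λ ()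
      ... | there j = j , subst₂ (λ x y → (false ∷ true ∷ ρ) x ≡ (false ∷ true ∷ ρ) y)
                                 (insertAt-punchIn _ i _ j) (insertAt-punchIn _ i _ j) e

  DisjEq-drop : DisjEq m q ∈⟨ single (DisjEq (suc m) p) ⟩
  DisjEq-drop = φ , λ ρ → ⇔-trans (drop-disjunct ρ) (⇔-sym (φ-sem ρ))

DisjEq-first₂ : (n : ℕ) (p : Fin (2 + n) → Fin k) →
                DisjEq 2 (p zero ∷ p (suc zero) ∷ []) ∈⟨ single (DisjEq (2 + n) p) ⟩
DisjEq-first₂ 0 p = atom zero id (++-cong _ _ p₀₁≗p p₀₁≗p) , λ ρ → ⇔-refl
  where
  p₀₁≗p : (p zero ∷ p (suc zero) ∷ []) ≗ p
  p₀₁≗p zero       = refl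
  p₀₁≗p (suc zero) = refl
DisjEq-first₂ (suc n) p =
  ∈⟨⟩-trans (λ { zero → DisjEq-drop p (suc (suc zero)) }) (single-extensional (DisjEq-extensional p))
    (DisjEq-first₂ n (p ∘ punchIn (suc (suc zero))))

module _ (n : ℕ) (p : Fin (2 + n) → Fin k) where

  private
    M : ℕ
    M = 2 + n

    τ : Fin (suc (M + M)) → Fin k
    τ = p (suc zero) ∷ sort (DisjEq M p)

    u v : Fin M → Fin (suc (M + M))
    u i = suc (i ↑ˡ M)
    v i = suc (M ↑ʳ i)

    us₂ vs₂ : Fin 2 → Fin (suc (M + M))
    us₂ = u zero ∷ zero ∷ []
    vs₂ = v zero ∷ u (suc zero) ∷ []

    us₂-sort : ∀ i → τ (us₂ i) ≡ (p zero ∷ p (suc zero) ∷ []) i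
    us₂-sort zero       = lookup-++ˡ p p zero
    us₂-sort (suc zero) = refl

    vs₂-sort : ∀ i → τ (vs₂ i) ≡ (p zero ∷ p (suc zero) ∷ []) i
    vs₂-sort zero       = lookup-++ʳ p p zero
    vs₂-sort (suc zero) = lookup-++ˡ p p (suc zero)

    us₁ vs₁ : Fin (suc n) → Fin (suc (M + M))
    us₁ = zero ∷ λ i → u (suc (suc i))
    vs₁ i = v (suc i)

    us₁-sort : ∀ i → τ (us₁ i) ≡ p (suc i)
    us₁-sort zero    = refl
    us₁-sort (suc i) = lookup-++ˡ p p (suc (suc i))

    -- ∃ w. (u₀ = v₀ ∨ w = u₁) ∧ (w = v₁ ∨ u₂ = v₂ ∨ … ∨ uₙ₊₁ = vₙ₊₁)
    φ : Formula (pair (DisjEq (suc n) (p ∘ suc)) (DisjEq 2 (p zero ∷ p (suc zero) ∷ []))) (M + M) (sort (DisjEq M p))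
    φ = exQ (p (suc zero)) (conj (atom (suc zero) (us₂ ++ vs₂) (++-sort τ us₂ vs₂ us₂-sort vs₂-sort))
                                 (atom zero (us₁ ++ vs₁) (++-sort τ us₁ vs₁ us₁-sort (λ i → lookup-++ʳ p p (suc i)))))

    Split : (Fin (M + M) → Bool) → Set
    Split ρ = Σ Bool λ w → (∃ λ i → (w ∷ ρ) (us₂ i) ≡ (w ∷ ρ) (vs₂ i)) × (∃ λ i → (w ∷ ρ) (us₁ i) ≡ (w ∷ ρ) (vs₁ i))

    φ-sem : ∀ ρ → ⟦ φ ⟧ ρ ⇔ Split ρ
    φ-sem ρ = Σ-cong-⇔ λ w → DisjEq-++ {p = p zero ∷ p (suc zero) ∷ []} (w ∷ ρ) us₂ vs₂
                              ×-⇔ DisjEq-++ {p = p ∘ suc} (w ∷ ρ) us₁ vs₁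

    split-disjunction : ∀ ρ → pred (DisjEq M p) ρ ⇔ Split ρ
    split-disjunction ρ = mk⇔ to from
      where
      to : pred (DisjEq M p) ρ → Split ρ
      to (zero , e)        = ρ (M ↑ʳ suc zero) , (zero , e) , (zero , refl)
      to (suc zero , e)    = ρ (suc zero) , (suc zero , refl) , (zero , e)
      to (suc (suc i) , e) = ρ (suc zero) , (suc zero , refl) , (suc i , e)

      from : Split ρ → pred (DisjEq M p) ρ
      from (_ , (zero , e) , _)                    = zero , e
      from (_ , (suc zero , w≡u₁) , (zero , w≡v₁)) = suc zero , trans (sym w≡u₁) w≡v₁
      from (_ , (suc zero , _) , (suc i , e))      = suc (suc i) , e

  DisjEq-merge : DisjEq M p ∈⟨ pair (DisjEq (suc n) (p ∘ suc)) (DisjEq 2 (p zero ∷ p (suc zero) ∷ [])) ⟩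
  DisjEq-merge = φ , λ ρ → ⇔-trans (split-disjunction ρ) (⇔-sym (φ-sem ρ))

module _ (s : Fin k) where

  Chain∈⟨DisjEq⟩ : Chain s ∈⟨ single (DisjEq 2 (λ _ → s)) ⟩
  Chain∈⟨DisjEq⟩ = atom zero (us ++ vs) (++-sort (λ _ → s) us vs (λ _ → refl) (λ _ → refl)) ,
                   λ ρ → ⇔-trans (mk⇔ (to {ρ}) (from {ρ})) (⇔-sym (DisjEq-++ {p = λ _ → s} ρ us vs))
    where
    us vs : Fin 2 → Fin 3
    us = zero ∷ suc zero ∷ []
    vs = suc zero ∷ suc (suc zero) ∷ []

    to : {ρ : Fin 3 → Bool} → pred (Chain s) ρ → ∃ λ i → ρ (us i) ≡ ρ (vs i)
    to (inj₁ x≡y) = zero , x≡y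
    to (inj₂ y≡z) = suc zero , y≡z

    from : {ρ : Fin 3 → Bool} → (∃ λ i → ρ (us i) ≡ ρ (vs i)) → pred (Chain s) ρ
    from (zero , x≡y)     = inj₁ x≡y
    from (suc zero , y≡z) = inj₂ y≡z

  private
    -- Context of the defining formula: b, a, then x, u, y, v.
    τ : Fin 6 → Fin k
    τ = s ∷ s ∷ sort (DisjEq 2 (λ _ → s))

    τ-const : ∀ w → τ w ≡ s
    τ-const zero          = refl
    τ-const (suc zero)    = refl
    τ-const (suc (suc j)) with splitAt 2 j
    ... | inj₁ _ = refl
    ... | inj₂ _ = refl

    chain : (x y z : Fin 6) → Formula (single (Chain s)) 6 τ
    chain x y z = atom zero (x ∷ y ∷ z ∷ []) λ { zero → τ-const x ; (suc zero) → τ-const y ; (suc (suc zero)) → τ-const z }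

    b a x u y v : Fin 6
    b = zero
    a = suc zero
    x = suc (suc zero)
    u = suc (suc (suc zero))
    y = suc (suc (suc (suc zero)))
    v = suc (suc (suc (suc (suc zero))))

    -- If x ≠ y, the first two atoms force a = y and b = x, so a ≠ b and the last two force u = v.
    φ : Formula (single (Chain s)) 4 (sort (DisjEq 2 (λ _ → s)))
    φ = exQ s (exQ s (conj (conj (chain x y a) (chain y x b)) (conj (chain u v a) (chain u v b))))

    φ-defines : ∀ ρ → pred (DisjEq 2 (λ _ → s)) ρ ⇔ ⟦ φ ⟧ ρ
    φ-defines ρ = mk⇔ to from
      where
      to : pred (DisjEq 2 (λ _ → s)) ρ → ⟦ φ ⟧ ρ
      to (zero , x≡y)     = ρ (suc (suc (suc zero))) , ρ (suc (suc (suc zero))) , (inj₁ x≡y , inj₁ (sym x≡y)) , (inj₂ refl , inj₂ refl)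
      to (suc zero , u≡v) = ρ (suc (suc zero)) , ρ zero , (inj₂ refl , inj₂ refl) , (inj₁ u≡v , inj₁ u≡v)

      from : ⟦ φ ⟧ ρ → pred (DisjEq 2 (λ _ → s)) ρ
      from (_ , _ , (inj₁ x≡y , _) , _)                          = zero , x≡y
      from (_ , _ , (inj₂ _ , inj₁ y≡x) , _)                     = zero , sym y≡x
      from (_ , _ , (inj₂ _ , inj₂ _) , (inj₁ u≡v , _))          = suc zero , u≡v
      from (_ , _ , (inj₂ _ , inj₂ _) , (inj₂ _ , inj₁ u≡v))     = suc zero , u≡v
      from (_ , _ , (inj₂ y≡a , inj₂ x≡b) , (inj₂ v≡a , inj₂ v≡b)) =
        zero , trans x≡b (trans (sym v≡b) (trans v≡a (sym y≡a)))

  DisjEq∈⟨Chain⟩ : DisjEq 2 (λ _ → s) ∈⟨ single (Chain s) ⟩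
  DisjEq∈⟨Chain⟩ = φ , φ-defines

lemma3p8 : (k : ℕ) →
    ((n : ℕ) (p : Fin (suc (suc n)) → Fin k) →
      single (DisjEq (suc (suc n)) p)
        ≐ pair (DisjEq (suc n) (λ i → p (suc i)))
               (DisjEq 2 (p zero ∷ p (suc zero) ∷ [])))
    × ((s : Fin k) → single (DisjEq 2 (λ _ → s)) ≐ single (Chain s))
lemma3p8 k =
  (λ n p → ≐-intro (single-extensional (DisjEq-extensional p))
                   (pair-extensional (DisjEq-extensional (λ i → p (suc i)))
                                     (DisjEq-extensional (p zero ∷ p (suc zero) ∷ [])))
                   (λ { zero → DisjEq-merge n p })
                   (λ { zero → DisjEq-drop p zero ; (suc zero) → DisjEq-first₂ n p })) ,
  (λ s → ≐-intro (single-extensional (DisjEq-extensional (λ _ → s))) (single-extensional (Chain-extensional s))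
                 (λ { zero → DisjEq∈⟨Chain⟩ s })
                 (λ { zero → Chain∈⟨DisjEq⟩ s }))
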